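{- Let $Y$ be an object of $\mathcal{S}$ which is total and inhabited. Then in the internal logic of $\mathcal{S}$: $\forall\,\kappa:\mathbb{K}.\ \forall\,\phi:\Omega^{Y}.\ \triangleright^{\kappa}\big(\exists\,y:Y.\ \phi(y)\big)\Rightarrow\exists\,y:Y.\ \triangleright^{\kappa}\phi(y)$.
   Context: Let $\mathbb{F}^+$ be the category whose objects are $\bullet^n$ for $n>0$ (free category with strictly associative binary products on one object); a morphism $\bullet^n\to\bullet^m$ is equivalently a function $\{0,\dots,m-1\}\to\{0,\dots,n-1\}$. Let $\mathcal{N}=\mathrm{Hom}_{\mathbb{F}^+}(-,\bullet^1)$. For $U\in\mathbb{F}^+$ let $\mathrm{CLK}[U]=\omega^{\mathcal{N}(U)}$ ordered pointwise, with $\mathrm{CLK}[f](\partial_V)=(\kappa\mapsto\partial_V(f^*\kappa))$ for $f:V\to U$. The category $\mathbb{CLK}$ has objects $\mathbf{U}=(U,\partial_U)$ and morphisms $f:(V,\partial_V)\to(U,\partial_U)$ the $\mathbb{F}^+$-maps $f:V\to U$ with $\mathrm{CLK}[f](\partial_V)\le\partial_U$. $\mathcal{S}$ is the presheaf topos on $\mathbb{CLK}$, with clock object $\mathbb{K}(U,\partial_U)=\mathcal{N}(U)$ and subobject classifier $\Omega$. Write $\mathbf{U}[\kappa\mapsto n]$ for $(U,\partial_U[\kappa\mapsto n])$, and for $\kappa\in\mathcal{N}(U)$ and $n\in\omega$ write $[\kappa\mathrel{+}=n]:\mathbf{U}\to\mathbf{U}[\kappa\mapsto\partial_U(\kappa)+n]$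 for the morphism with identity underlying $\mathbb{F}^+$-map. The later modality is defined by forcing: $\mathbf{U}\Vdash\triangleright^{\kappa}\phi(\alpha)$ iff $\partial_U(\kappa)=0$, or $\partial_U(\kappa)=n+1$ and $\mathbf{U}[\kappa\mapsto n]\Vdash\phi([\kappa\mathrel{+}=1]^*\alpha)$; other connectives have standard Kripke–Joyal semantics. An object $X\in\mathcal{S}$ is total if for every such restriction map $[\kappa\mathrel{+}=n]$ the function $X([\kappa\mathrel{+}=n])$ is surjective; $X$ is inhabited if the formula $\exists\,x:X.\ \top$ is valid in the internal logic of $\mathcal{S}$. -}

module Defs where

open import Data.Nat using (ℕ; zero; suc; _+_; _≤_)
open import Data.Nat.Properties using (≤-refl; ≤-trans; m≤m+n; n≤1+n)
open import Data.Fin using (Fin)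
open import Data.Fin.Properties using (_≟_)
open import Data.Product using (Σ; ∃; _×_; _,_)
open import Data.Sum using (_⊎_)
open import Relation.Nullary using (yes; no)
open import Relation.Binary.PropositionalEquality using (_≡_; refl; sym; subst)

-- Objects of 𝔽⁺ are •^n with n > 0; we encode •^(suc k) by k.
-- A morphism •^n → •^m is a function Fin m → Fin n.
-- 𝒩(•^n) = Hom(•^n, •¹) ≅ (Fin 1 → Fin n) ≅ Fin n, and for f : V → U,
-- f^*κ = κ ∘ f corresponds to the function value f κ.

record Obj : Set where
  constructor obj
  field
    k : ℕ
    ∂ : Fin (suc k) → ℕ
open Obj public

dim : Obj → ℕ
dim U = suc (k U)

Clk : Obj → Set
Clk U = Fin (dim U)

record Hom (V U : Obj) : Set where
  constructor hom
  field
    fun : Fin (dim U) → Fin (dim V)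
    .le : ∀ κ → ∂ V (fun κ) ≤ ∂ U κ
open Hom public

idH : ∀ {U} → Hom U U
idH = hom (λ κ → κ) (λ κ → ≤-refl)

_∘H_ : ∀ {W V U} → Hom V U → Hom W V → Hom W U
hom h' lh ∘H hom g' lg = hom (λ κ → g' (h' κ)) (λ κ → ≤-trans (lg (h' κ)) (lh κ))

record Presheaf : Set₁ where
  field
    F     : Obj → Set
    map   : ∀ {V U} → Hom V U → F U → F V
    map-id : ∀ {U} (x : F U) → map (idH {U}) x ≡ x
    map-∘  : ∀ {W V U} (h : Hom V U) (g : Hom W V) (x : F U) →
             map (h ∘H g) x ≡ map g (map h x)
open Presheaf public

upd : ∀ {m} → (Fin m → ℕ) → Fin m → ℕ → Fin m → ℕ
upd d κ n κ' with κ' ≟ κ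
... | yes _ = n
... | no  _ = d κ'

_[_↦_] : (U : Obj) → Clk U → ℕ → Obj
U [ κ ↦ n ] = obj (k U) (upd (∂ U) κ n)

private
  adv-le : (U : Obj) (κ : Clk U) (n : ℕ) (κ' : Clk U) →
           ∂ U κ' ≤ upd (∂ U) κ (∂ U κ + n) κ'
  adv-le U κ n κ' with κ' ≟ κ
  ... | yes refl = m≤m+n (∂ U κ) n
  ... | no  _    = ≤-refl

  tick-le : (U : Obj) (κ : Clk U) (n : ℕ) → ∂ U κ ≡ suc n → (κ' : Clk U) →
            upd (∂ U) κ n κ' ≤ ∂ U κ'
  tick-le U κ n e κ' with κ' ≟ κ
  ... | yes refl = subst (n ≤_) (sym e) (n≤1+n n)
  ... | no  _    = ≤-refl

adv : (U : Obj) (κ : Clk U) (n : ℕ) → Hom U (U [ κ ↦ ∂ U κ + n ])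
adv U κ n = hom (λ κ' → κ') (adv-le U κ n)

-- [κ += 1] : U[κ ↦ n] → U[κ ↦ n][κ ↦ n+1], where the target is (extensionally)
-- U itself whenever ∂_U(κ) = n + 1; we take U as codomain.
tick : (U : Obj) (κ : Clk U) (n : ℕ) → ∂ U κ ≡ suc n → Hom (U [ κ ↦ n ]) U
tick U κ n e = hom (λ κ' → κ') (tick-le U κ n e)

Total : Presheaf → Set
Total X = ∀ (U : Obj) (κ : Clk U) (n : ℕ) (x : F X U) →
          ∃ λ (x' : F X (U [ κ ↦ ∂ U κ + n ])) → map X (adv U κ n) x' ≡ x

-- U ⊩ ∃ x : X. ⊤  iff X(U) is nonempty (presheaf topos, Kripke–Joyal);
-- validity means this at every stage.
Inhabited : Presheaf → Set
Inhabited X = ∀ (U : Obj) → F X U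

-- Elements of Ω^Y at stage U: subobjects of y(U) × Y, i.e. predicates on
-- pairs (g : W → U , y ∈ Y(W)) closed under restriction.

record ΩY (Y : Presheaf) (U : Obj) : Set₁ where
  field
    P      : (W : Obj) → Hom W U → F Y W → Set
    closed : ∀ {W W'} (g : Hom W U) (h : Hom W' W) (y : F Y W) →
             P W g y → P W' (g ∘H h) (map Y h y)
open ΩY public

restrict : ∀ {Y V U} → ΩY Y U → Hom V U → ΩY Y V
restrict φ h = record
  { P      = λ W g y → P φ W (h ∘H g) y
  ; closed = λ g k y p → closed φ (h ∘H g) k y p }

_⊩_at_ : ∀ {Y} (V : Obj) → ΩY Y V → F Y V → Set
V ⊩ φ at y = P φ V idH y

-- V ⊩ ▷^κ ψ : ∂_V(κ) = 0, or ∂_V(κ) = n+1 and V[κ↦n] ⊩ (restricted ψ);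
-- ψ n e is the forcing at V[κ↦n] of ψ with its free variables
-- restricted along tick V κ n e = [κ += 1].
Later : (V : Obj) (κ : Clk V) → ((n : ℕ) → ∂ V κ ≡ suc n → Set) → Set
Later V κ ψ = (∂ V κ ≡ 0) ⊎ Σ ℕ (λ n → Σ (∂ V κ ≡ suc n) (λ e → ψ n e))

LaterExists : (Y : Presheaf) (V : Obj) (κ : Clk V) → ΩY Y V → Set
LaterExists Y V κ φ =
  Later V κ (λ n e →
    Σ (F Y (V [ κ ↦ n ])) (λ y → (V [ κ ↦ n ]) ⊩ restrict φ (tick V κ n e) at y))

ExistsLater : (Y : Presheaf) (V : Obj) (κ : Clk V) → ΩY Y V → Set
ExistsLater Y V κ φ =
  Σ (F Y V) (λ y → Later V κ (λ n e →
    (V [ κ ↦ n ]) ⊩ restrict φ (tick V κ n e) at map Y (tick V κ n e) y))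

module Submission where

-- If ∂_V(κ) = 0 the later modality holds trivially, and an element of
-- Y(V) exists because Y is inhabited.  If ∂_V(κ) = n+1, the hypothesis
-- gives y ∈ Y(V[κ↦n]) with V[κ↦n] ⊩ φ(y); it suffices to find x ∈ Y(V)
-- restricting to y along tick = [κ += 1] : V[κ↦n] → V.
--
-- Such x exists for any total Y: totality lifts y along
-- [κ += 1] : V[κ↦n] → V[κ↦n][κ↦n+1], and V sits below the latter
-- object by an identity-underlying map (the clock update with n and
-- then n+1 restores ∂_V, see upd-restore).  Composing the two maps
-- gives back tick, so restricting the lift to V yields x
-- (lift-along-tick).

open import Defs
open import Data.Nat using (ℕ; suc; _+_; _≤_)
open import Data.Nat.Properties using (≤-reflexive; +-comm)
open import Data.Fin using (Fin)
open import Data.Fin.Properties using (_≟_)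
open import Data.Product using (∃; _,_)
open import Data.Sum using (inj₁; inj₂)
open import Relation.Nullary using (yes; no; contradiction)
open import Relation.Binary.PropositionalEquality
  using (_≡_; refl; sym; trans; cong; subst)

upd-self : ∀ {m} (d : Fin m → ℕ) (κ : Fin m) (n : ℕ) → upd d κ n κ ≡ n
upd-self d κ n with κ ≟ κ
... | yes _  = refl
... | no κ≢κ = contradiction refl κ≢κ

upd-restore : ∀ {m} (d : Fin m → ℕ) (κ : Fin m) (n : ℕ) (κ' : Fin m) →
              upd (upd d κ n) κ (d κ) κ' ≡ d κ'
upd-restore d κ n κ' with κ' ≟ κ
... | yes refl = refl
... | no κ'≢κ with κ' ≟ κ
...   | yes κ'≡κ = contradiction κ'≡κ κ'≢κ
...   | no _     = refl

restore : (V : Obj) (κ : Clk V) (n : ℕ) → ∂ V κ ≡ suc n →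
          Hom V ((V [ κ ↦ n ]) [ κ ↦ ∂ (V [ κ ↦ n ]) κ + 1 ])
restore V κ n e = hom (λ κ' → κ') restore-le
  where
  clock-restored : ∂ (V [ κ ↦ n ]) κ + 1 ≡ ∂ V κ
  clock-restored = trans (cong (_+ 1) (upd-self (∂ V) κ n))
                         (trans (+-comm n 1) (sym e))

  restore-le : ∀ κ' → ∂ V κ' ≤ upd (upd (∂ V) κ n) κ (∂ (V [ κ ↦ n ]) κ + 1) κ'
  restore-le κ' = ≤-reflexive (sym (subst
    (λ t → upd (upd (∂ V) κ n) κ t κ' ≡ ∂ V κ')
    (sym clock-restored) (upd-restore (∂ V) κ n κ')))

-- On a total object every element at stage V[κ↦n] is the restriction of
-- an element at V along tick = [κ += 1].  (restore ∘ tick is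
-- definitionally the map [κ += 1] used by totality, as both have the
-- identity as underlying function.)
lift-along-tick : (Y : Presheaf) → Total Y →
                  (V : Obj) (κ : Clk V) (n : ℕ) (e : ∂ V κ ≡ suc n)
                  (y : F Y (V [ κ ↦ n ])) →
                  ∃ λ (x : F Y V) → map Y (tick V κ n e) x ≡ y
lift-along-tick Y total V κ n e y with total (V [ κ ↦ n ]) κ 1 y
... | y' , y'↦y =
  map Y (restore V κ n e) y' ,
  trans (sym (map-∘ Y (restore V κ n e) (tick V κ n e) y')) y'↦y

later-exists⇒exists-later : (Y : Presheaf) → Total Y → Inhabited Y →
                            (V : Obj) (κ : Clk V) (φ : ΩY Y V) →
                            LaterExists Y V κ φ → ExistsLater Y V κ φ
later-exists⇒exists-later Y total inhabited V κ φ (inj₁ κ-zero) =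
  inhabited V , inj₁ κ-zero
later-exists⇒exists-later Y total inhabited V κ φ (inj₂ (n , e , y , φy))
  with lift-along-tick Y total V κ n e y
... | x , x↦y =
  x , inj₂ (n , e , subst (P φ (V [ κ ↦ n ]) (tick V κ n e ∘H idH)) (sym x↦y) φy)

mainTheorem9 : (Y : Presheaf) → Total Y → Inhabited Y →
    (U : Obj) (κ : Clk U) (φ : ΩY Y U) →
    ∀ {W : Obj} (h : Hom W U) →
    LaterExists Y W (fun h κ) (restrict φ h) →
    ExistsLater Y W (fun h κ) (restrict φ h)
mainTheorem9 Y total inhabited U κ φ {W} h =
  later-exists⇒exists-later Y total inhabited W (fun h κ) (restrict φ h)
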